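{- Let $n \geq 1$ be an integer and consider the Build Up 1-2-3 game on $n$. If $n = 4$ or $n$ is odd, Player 1 has a winning strategy; if $n$ is even and $n \neq 4$, Player 2 has a winning strategy.
   Context: Fibonacci numbers are indexed $F_1=1$, $F_2=2$, $F_3 = 3$, $F_{k+1}=F_k+F_{k-1}$. Reversed Zeckendorf game from a given position: a position is a multiset of Fibonacci numbers ("chips"), with $h_k$ the number of chips equal to $F_k$; two players alternate moves; legal moves are: (Split) for $k \geq 3$, if $h_k \geq 1$, replace one chip $F_k$ by chips $F_{k-1}$ and $F_{k-2}$; if $h_2 \geq 1$, replace one chip $F_2$ by two chips $F_1$. (Combine) for $k > 2$, if $h_{k-2}\ge1$ and $h_{k+1} \geq 1$, replace one chip $F_{k-2}$ and one chip $F_{k+1}$ by two chips $F_k$; if $h_1 \geq 1$ and $h_3 \geq 1$, replace one chip $F_1$ and one chip $F_3$ by two chips $F_2$. A player who cannot move loses. Build Up 1-2-3 game on $n$: Players 1 and 2 alternately (Player 1 first) put down a number $1$, $2$ or $3$, with the running total of all numbers put down never exceeding $n$, until the total equals exactly $n$. This yields a position with $a$ ones, $b$ twos and $c$ threes. The players then play the reversed Zeckendorf game from this position, with the first move made by the player who did not put down the last number. The winner of this reversed Zeckendorf game wins the Build Up game. -}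

module Defs where

open import Data.Nat using (ℕ; zero; suc; _+_; _*_; _∸_; _≤_; _<_; _%_)
open import Data.List using (List; []; _∷_)
open import Relation.Binary.PropositionalEquality using (_≡_)

fib : ℕ → ℕ
fib zero = 0
fib (suc zero) = 1
fib (suc (suc zero)) = 2
fib (suc (suc (suc k))) = fib (suc (suc k)) + fib (suc k)

-- A position (multiset of Fibonacci numbers) is a list
--   h_1 ∷ h_2 ∷ h_3 ∷ …
-- where h_k is the number of chips equal to F_k; entries beyond the end
-- of the list are 0.

Pos : Set
Pos = List ℕ

-- chips h k = h_k  (1-based; chips h 0 = 0 is never used)
at : Pos → ℕ → ℕ
at []       _       = 0
at (x ∷ h)  zero    = x
at (x ∷ h)  (suc i) = at h i

chips : Pos → ℕ → ℕ
chips h zero    = 0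
chips h (suc i) = at h i

addAt : ℕ → Pos → Pos
addAt zero    []      = 1 ∷ []
addAt zero    (x ∷ h) = suc x ∷ h
addAt (suc i) []      = 0 ∷ addAt i []
addAt (suc i) (x ∷ h) = x ∷ addAt i h

removeAt : ℕ → Pos → Pos
removeAt _       []      = []
removeAt zero    (x ∷ h) = (x ∸ 1) ∷ h
removeAt (suc i) (x ∷ h) = x ∷ removeAt i h

-- add / remove one chip F_k (k ≥ 1)
add : ℕ → Pos → Pos
add zero    h = h
add (suc i) h = addAt i h

remove : ℕ → Pos → Pos
remove zero    h = h
remove (suc i) h = removeAt i h

data Move : Pos → Pos → Set where
  splitK   : ∀ {h} k → 3 ≤ k → 1 ≤ chips h k →
             Move h (add (k ∸ 1) (add (k ∸ 2) (remove k h)))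
  split2   : ∀ {h} → 1 ≤ chips h 2 →
             Move h (add 1 (add 1 (remove 2 h)))
  combineK : ∀ {h} k → 2 < k → 1 ≤ chips h (k ∸ 2) → 1 ≤ chips h (suc k) →
             Move h (add k (add k (remove (k ∸ 2) (remove (suc k) h))))
  combine13 : ∀ {h} → 1 ≤ chips h 1 → 1 ≤ chips h 3 →
             Move h (add 2 (add 2 (remove 1 (remove 3 h))))

-- Winning / losing positions for the player about to move
-- (a player who cannot move loses).  Being inductive, these describe
-- strategies that win in finitely many moves.
mutual
  data ZWin (h : Pos) : Set where
    zwin : ∀ h' → Move h h' → ZLose h' → ZWin h

  data ZLose (h : Pos) : Set where
    zlose : (∀ h' → Move h h' → ZWin h') → ZLose h

-- State: a ones, b twos, c threes put down so far (running total
-- a + 2b + 3c).  When the total reaches n, the player whose turn it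
-- would be next (i.e. the one who did NOT put down the last number)
-- makes the first move of the reversed Zeckendorf game from the position
-- with a chips F_1, b chips F_2, c chips F_3.

total : ℕ → ℕ → ℕ → ℕ
total a b c = a + 2 * b + 3 * c

startPos : ℕ → ℕ → ℕ → Pos
startPos a b c = a ∷ b ∷ c ∷ []

data BMove (n : ℕ) : ℕ → ℕ → ℕ → ℕ → ℕ → ℕ → Set where
  put1 : ∀ {a b c} → total (suc a) b c ≤ n → BMove n a b c (suc a) b c
  put2 : ∀ {a b c} → total a (suc b) c ≤ n → BMove n a b c a (suc b) c
  put3 : ∀ {a b c} → total a b (suc c) ≤ n → BMove n a b c a b (suc c)

mutual
  data BWin (n : ℕ) (a b c : ℕ) : Set where
    bend  : total a b c ≡ n → ZWin (startPos a b c) → BWin n a b c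
    bstep : ∀ {a' b' c'} → BMove n a b c a' b' c' → BLose n a' b' c' → BWin n a b c

  data BLose (n : ℕ) (a b c : ℕ) : Set where
    blend  : total a b c ≡ n → ZLose (startPos a b c) → BLose n a b c
    blstep : total a b c < n →
             (∀ {a' b' c'} → BMove n a b c a' b' c' → BWin n a' b' c') →
             BLose n a b c

Player1Wins : ℕ → Set
Player1Wins n = BWin n 0 0 0

Player2Wins : ℕ → Set
Player2Wins n = BLose n 0 0 0

Odd : ℕ → Set
Odd n = n % 2 ≡ 1

Even : ℕ → Set
Even n = n % 2 ≡ 0

{-# OPTIONS --safe #-}
module Submission where

-- Only F₁, F₂, F₃ ever occur in the reversed Zeckendorf game started from a ones, b twos and
-- c threes, and the player to move loses exactly when b and min(a, c) are both even: every move
-- from such a position breaks this, and from any other position one of the three moves restores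
-- it.  In the building phase, with R still to be put down, the player to move wins when R ≥ 2 and
-- R + b is odd, and loses when R ≥ 5 and R + b is even; the positions with R ≤ 5 are settled
-- directly by the Zeckendorf characterisation.  Starting from b = 0 this decides every n except
-- n = 4, where putting down 3 forces the Zeckendorf position (1, 0, 1), lost for its first mover.

open import Defs
open import Algebra.Properties.CommutativeSemigroup using (x∙yz≈y∙xz)
open import Data.Empty using (⊥; ⊥-elim)
open import Data.Nat using (ℕ; zero; suc; _+_; _*_; _⊓_; _≤_; _<_; z≤n; s≤s; parity)
open import Data.Nat.Properties
  using (+-assoc; +-suc; +-identityʳ; +-cancelʳ-≤; +-commutativeSemigroup;
         m≤n+m; m≤n⇒m≤1+n; ≤⇒≯; ≤-refl; n≤1+n)
open import Data.Nat.Tactic.RingSolver using (solve-∀)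
open import Data.Parity.Base using (0ℙ; 1ℙ; _⁻¹)
open import Data.Parity.Properties using (suc-homo-⁻¹; ⁻¹-selfInverse)
open import Data.Product using (_×_; _,_)
open import Data.Sum using (_⊎_; inj₁; inj₂)
open import Relation.Binary.PropositionalEquality
  using (_≡_; _≢_; refl; sym; trans; cong; subst; module ≡-Reasoning)

parity-suc : ∀ n {p} → parity n ≡ p → parity (suc n) ≡ p ⁻¹
parity-suc n eq = trans (sym (⁻¹-selfInverse (suc-homo-⁻¹ n))) (cong _⁻¹ eq)

parity-pred : ∀ n {p} → parity (suc n) ≡ p → parity n ≡ p ⁻¹
parity-pred n eq = trans (sym (suc-homo-⁻¹ n)) (cong _⁻¹ eq)

-- suc (suc n) % 2 reduces to n % 2, so both recursions go through definitionally.
Odd⇒parity≡1ℙ : ∀ n → Odd n → parity n ≡ 1ℙ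
Odd⇒parity≡1ℙ 0             ()
Odd⇒parity≡1ℙ 1             _   = refl
Odd⇒parity≡1ℙ (suc (suc n)) odd = Odd⇒parity≡1ℙ n odd

Even⇒parity≡0ℙ : ∀ n → Even n → parity n ≡ 0ℙ
Even⇒parity≡0ℙ 0             _    = refl
Even⇒parity≡0ℙ 1             ()
Even⇒parity≡0ℙ (suc (suc n)) even = Even⇒parity≡0ℙ n even

-- The positions after a move are given explicitly: inferring them from the goal would leave
-- unreduced terms such as suc c ∸ 1, which the termination checker cannot compare.
mutual
  ZWin-oddTwos : ∀ {a b c} → parity b ≡ 1ℙ → ZWin (startPos a b c)
  ZWin-oddTwos {b = zero} ()
  ZWin-oddTwos {a} {suc b} {c} odd with parity (suc (suc a) ⊓ c) in min-parity
  ... | 0ℙ = zwin _ (split2 (s≤s z≤n))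
                    (ZLose-evenEven {suc (suc a)} {b} {c} (parity-pred b odd) min-parity)
  ZWin-oddTwos {a} {suc b} {zero} odd | 1ℙ with () ← min-parity
  ZWin-oddTwos {a} {suc b} {suc c} odd | 1ℙ =
    zwin _ (splitK 3 (s≤s (s≤s (s≤s z≤n))) (s≤s z≤n))
           (ZLose-evenEven {suc a} {suc (suc b)} {c} (parity-pred b odd)
                           (parity-pred (suc a ⊓ c) min-parity))

  ZWin-oddMin : ∀ {a b c} → parity b ≡ 0ℙ → parity (a ⊓ c) ≡ 1ℙ → ZWin (startPos a b c)
  ZWin-oddMin {zero}  {c = c}     _    ()
  ZWin-oddMin {suc a} {c = zero}  _    ()
  ZWin-oddMin {suc a} {b} {suc c} even odd =
    zwin _ (combine13 (s≤s z≤n) (s≤s z≤n))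
           (ZLose-evenEven {a} {suc (suc b)} {c} even (parity-pred (a ⊓ c) odd))

  ZLose-evenEven : ∀ {a b c} → parity b ≡ 0ℙ → parity (a ⊓ c) ≡ 0ℙ → ZLose (startPos a b c)
  ZLose-evenEven even-b even-min = zlose (ZWin-after-evenEven even-b even-min)

  ZWin-after-evenEven : ∀ {a b c} → parity b ≡ 0ℙ → parity (a ⊓ c) ≡ 0ℙ →
                        ∀ h → Move (startPos a b c) h → ZWin h
  ZWin-after-evenEven _ _ _ (splitK 0 () _)
  ZWin-after-evenEven _ _ _ (splitK 1 (s≤s ()) _)
  ZWin-after-evenEven _ _ _ (splitK 2 (s≤s (s≤s ())) _)
  ZWin-after-evenEven {a} {b} {suc c} even-b _ _ (splitK 3 _ _) =
    ZWin-oddTwos {suc a} {suc b} {c} (parity-suc b even-b)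
  ZWin-after-evenEven _ _ _ (splitK (suc (suc (suc (suc k)))) _ ())
  ZWin-after-evenEven {a} {suc b} {c} even-b _ _ (split2 _) =
    ZWin-oddTwos {suc (suc a)} {b} {c} (parity-pred b even-b)
  ZWin-after-evenEven _ _ _ (combineK 0 () _ _)
  ZWin-after-evenEven _ _ _ (combineK 1 (s≤s ()) _ _)
  ZWin-after-evenEven _ _ _ (combineK 2 (s≤s (s≤s ())) _ _)
  ZWin-after-evenEven _ _ _ (combineK (suc (suc (suc k))) _ _ ())
  ZWin-after-evenEven {suc a} {b} {suc c} even-b even-min _ (combine13 _ _) =
    ZWin-oddMin {a} {suc (suc b)} {c} even-b (parity-pred (a ⊓ c) even-min)

total-put1 : ∀ a b c → total (suc a) b c ≡ 1 + total a b c
total-put1 a b c = refl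

total-put2 : ∀ a b c → total a (suc b) c ≡ 2 + total a b c
total-put2 = identity
  where
  identity : ∀ a b c → a + 2 * suc b + 3 * c ≡ 2 + (a + 2 * b + 3 * c)
  identity = solve-∀

total-put3 : ∀ a b c → total a b (suc c) ≡ 3 + total a b c
total-put3 = identity
  where
  identity : ∀ a b c → a + 2 * b + 3 * suc c ≡ 3 + (a + 2 * b + 3 * c)
  identity = solve-∀

module _ {n : ℕ} where

  record Remaining (R a b c : ℕ) : Set where
    constructor remaining
    field fills : R + total a b c ≡ n
  open Remaining

  placed : ∀ k {R a b c a′ b′ c′} → total a′ b′ c′ ≡ k + total a b c →
           Remaining (k + R) a b c → Remaining R a′ b′ c′
  placed k {R} {a} {b} {c} {a′} {b′} {c′} grows r = remaining (begin
    R + total a′ b′ c′      ≡⟨ cong (R +_) grows ⟩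
    R + (k + total a b c)   ≡⟨ x∙yz≈y∙xz +-commutativeSemigroup R k (total a b c) ⟩
    k + (R + total a b c)   ≡⟨ sym (+-assoc k R (total a b c)) ⟩
    k + R + total a b c     ≡⟨ fills r ⟩
    n                       ∎)
    where open ≡-Reasoning

  after-put1 : ∀ {R a b c} → Remaining (1 + R) a b c → Remaining R (suc a) b c
  after-put1 {a = a} {b} {c} = placed 1 (total-put1 a b c)

  after-put2 : ∀ {R a b c} → Remaining (2 + R) a b c → Remaining R a (suc b) c
  after-put2 {a = a} {b} {c} = placed 2 (total-put2 a b c)

  after-put3 : ∀ {R a b c} → Remaining (3 + R) a b c → Remaining R a b (suc c)
  after-put3 {a = a} {b} {c} = placed 3 (total-put3 a b c)

  bounded : ∀ {R a b c} → Remaining R a b c → total a b c ≤ n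
  bounded {R} {a} {b} {c} r = subst (total a b c ≤_) (fills r) (m≤n+m (total a b c) R)

  unfinished : ∀ {R a b c} → Remaining (suc R) a b c → total a b c < n
  unfinished r = bounded (after-put1 r)

  cannot-place : ∀ k {R a b c} → Remaining R a b c → R < k → k + total a b c ≤ n → ⊥
  cannot-place k {R} {a} {b} {c} r R<k fits =
    ≤⇒≯ (+-cancelʳ-≤ (total a b c) k R (subst (k + total a b c ≤_) (sym (fills r)) fits)) R<k

  start : Remaining n 0 0 0
  start = remaining (+-identityʳ n)

  BWin-put1 : ∀ {R a b c} → Remaining (1 + R) a b c →
              (Remaining R (suc a) b c → BLose n (suc a) b c) → BWin n a b c
  BWin-put1 r next = bstep (put1 (bounded (after-put1 r))) (next (after-put1 r))

  BWin-put2 : ∀ {R a b c} → Remaining (2 + R) a b c →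
              (Remaining R a (suc b) c → BLose n a (suc b) c) → BWin n a b c
  BWin-put2 r next = bstep (put2 (bounded (after-put2 r))) (next (after-put2 r))

  BWin-put3 : ∀ {R a b c} → Remaining (3 + R) a b c →
              (Remaining R a b (suc c) → BLose n a b (suc c)) → BWin n a b c
  BWin-put3 r next = bstep (put3 (bounded (after-put3 r))) (next (after-put3 r))

  BWin-lastPut : ∀ {a b c} → Remaining 1 a b c → ZLose (startPos (suc a) b c) → BWin n a b c
  BWin-lastPut r lose = BWin-put1 r (λ r′ → blend (fills r′) lose)

  BLose-lastPut : ∀ {a b c} → Remaining 1 a b c → ZWin (startPos (suc a) b c) → BLose n a b c
  BLose-lastPut {a} {b} {c} r win = blstep (unfinished r) λ where
    (put1 _)    → bend (fills (after-put1 r)) win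
    (put2 fits) → ⊥-elim (cannot-place 2 r ≤-refl (subst (_≤ n) (total-put2 a b c) fits))
    (put3 fits) → ⊥-elim (cannot-place 3 r (n≤1+n 2) (subst (_≤ n) (total-put3 a b c) fits))

  BLose-twoLeft : ∀ {a b c} → Remaining 2 a b c →
                  parity b ≡ 0ℙ → parity (suc (suc a) ⊓ c) ≡ 0ℙ → BLose n a b c
  BLose-twoLeft {a} {b} {c} r even-b even-min = blstep (unfinished r) λ where
    (put1 _)    → BWin-lastPut (after-put1 r) (ZLose-evenEven even-b even-min)
    (put2 _)    → bend (fills (after-put2 r)) (ZWin-oddTwos (parity-suc b even-b))
    (put3 fits) → ⊥-elim (cannot-place 3 r ≤-refl (subst (_≤ n) (total-put3 a b c) fits))

  BLose-threeLeft : ∀ {a b c} → Remaining 3 a b c →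
                    parity b ≡ 1ℙ → parity (suc a ⊓ c) ≡ 0ℙ → BLose n a b c
  BLose-threeLeft {b = b} r odd-b even-min = blstep (unfinished r) λ where
    (put1 _) → BWin-put1 (after-put1 r) (λ r′ → BLose-lastPut r′ (ZWin-oddTwos odd-b))
    (put2 _) → BWin-lastPut (after-put2 r) (ZLose-evenEven (parity-suc b odd-b) even-min)
    (put3 _) → bend (fills (after-put3 r)) (ZWin-oddTwos odd-b)

  BWin-fiveLeft : ∀ {a b c} → Remaining 5 a b c → parity b ≡ 0ℙ → BWin n a b c
  BWin-fiveLeft {a} {b} {c} r even-b with parity (suc a ⊓ c) in min-parity
  ... | 0ℙ = BWin-put2 r (λ r′ → BLose-threeLeft r′ (parity-suc b even-b) min-parity)
  ... | 1ℙ = BWin-put3 r (λ r′ → BLose-twoLeft r′ even-b (parity-suc (suc a ⊓ c) min-parity))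

  -- The opponent's replies are a separate clause-defined function rather than a λ, so that the
  -- termination checker sees the remaining amount decrease along every recursive call.
  mutual
    BWin-odd : ∀ R {a b c} → Remaining R a b c → 2 ≤ R → parity (R + b) ≡ 1ℙ → BWin n a b c
    BWin-odd 1 _ (s≤s ()) _
    BWin-odd 2 r _ odd = BWin-put1 r (λ r′ → BLose-lastPut r′ (ZWin-oddTwos odd))
    BWin-odd 3 r _ odd = BWin-put2 r (λ r′ → BLose-lastPut r′ (ZWin-oddTwos odd))
    BWin-odd 4 r _ odd = BWin-put3 r (λ r′ → BLose-lastPut r′ (ZWin-oddTwos odd))
    BWin-odd 5 {b = b} r _ odd = BWin-fiveLeft r (parity-pred b odd)
    BWin-odd (suc R@(suc (suc (suc (suc (suc _)))))) {b = b} r _ odd =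
      BWin-put1 r (λ r′ → BLose-even R r′ (s≤s (s≤s (s≤s (s≤s (s≤s z≤n))))) (parity-pred (R + b) odd))

    BLose-even : ∀ R {a b c} → Remaining R a b c → 5 ≤ R → parity (R + b) ≡ 0ℙ → BLose n a b c
    BLose-even (suc R) r 5≤R even = blstep (unfinished r) (BWin-after-even (suc R) r 5≤R even)

    BWin-after-even : ∀ R {a b c} → Remaining R a b c → 5 ≤ R → parity (R + b) ≡ 0ℙ →
                      ∀ {a′ b′ c′} → BMove n a b c a′ b′ c′ → BWin n a′ b′ c′
    BWin-after-even (suc R@(suc (suc _))) {b = b} r (s≤s (s≤s (s≤s _))) even (put1 _) =
      BWin-odd R (after-put1 r) (s≤s (s≤s z≤n)) (parity-pred (R + b) even)
    BWin-after-even (suc R@(suc R′@(suc R″))) {b = b} r (s≤s (s≤s (s≤s 2≤R″))) even (put2 _) =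
      BWin-odd R′ (after-put2 r) (m≤n⇒m≤1+n 2≤R″)
               (trans (cong parity (+-suc R′ b)) (parity-pred (R + b) even))
    BWin-after-even (suc (suc (suc R″))) {b = b} r (s≤s (s≤s (s≤s 2≤R″))) even (put3 _) =
      BWin-odd R″ (after-put3 r) 2≤R″ (parity-pred (R″ + b) even)

Player1Wins-odd : ∀ n → Odd n → Player1Wins n
Player1Wins-odd 0 ()
Player1Wins-odd 1 _ = BWin-lastPut start (ZLose-evenEven refl refl)
Player1Wins-odd n@(suc (suc _)) odd =
  BWin-odd n start (s≤s (s≤s z≤n)) (trans (cong parity (+-identityʳ n)) (Odd⇒parity≡1ℙ n odd))

Player1Wins-4 : Player1Wins 4
Player1Wins-4 = BWin-put3 start (λ r → BLose-lastPut r (ZWin-oddMin refl refl))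

Player2Wins-even : ∀ n → Even n → n ≢ 4 → Player2Wins n
Player2Wins-even 0 _ _   = blend refl (ZLose-evenEven refl refl)
Player2Wins-even 1 () _
Player2Wins-even 2 _ _   = BLose-twoLeft start refl refl
Player2Wins-even 3 () _
Player2Wins-even 4 _ n≢4 = ⊥-elim (n≢4 refl)
Player2Wins-even n@(suc (suc (suc (suc (suc _))))) even _ =
  BLose-even n start (s≤s (s≤s (s≤s (s≤s (s≤s z≤n)))))
             (trans (cong parity (+-identityʳ n)) (Even⇒parity≡0ℙ n even))

theorem5p1 : (n : ℕ) → 1 ≤ n →
    ((n ≡ 4 ⊎ Odd n) → Player1Wins n) × ((Even n × n ≢ 4) → Player2Wins n)
theorem5p1 n _ = player1 , λ (even , n≢4) → Player2Wins-even n even n≢4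
  where
  player1 : (n ≡ 4 ⊎ Odd n) → Player1Wins n
  player1 (inj₁ refl) = Player1Wins-4
  player1 (inj₂ odd)  = Player1Wins-odd n odd
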